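{- Let $m$ be an odd positive integer and $\delta\in\mathbb{F}_{2^{2m}}$. Then $$f(x)=x+\left(\mathrm{Tr}_m^{2m}(x)^{(2^m+1)/3}+\delta\right)^{2^{m-1}+1}$$ is a permutation polynomial of $\mathbb{F}_{2^{2m}}$ and its compositional inverse over $\mathbb{F}_{2^{2m}}$ is $$f^{ -1}(x)=x+\left(\left(\mathrm{Tr}_m^{2m}(x)^2+\delta^3+\delta^{3\cdot2^m}\right)^{(2^{m+1}-1)/3}+\delta^{2^m}\right)^{2^{m-1}+1}.$$
   Context: $\mathrm{Tr}_m^{2m}(x)=x+x^{2^m}$ is the trace map from $\mathbb{F}_{2^{2m}}$ to $\mathbb{F}_{2^m}$. The compositional inverse of a permutation polynomial $F$ of a finite field $\mathbb{F}$ is the unique polynomial map $F^{ -1}$ with $F(F^{ -1}(x))=F^{ -1}(F(x))=x$ for all $x\in\mathbb{F}$. -}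

module Defs where

open import Level using (_⊔_)
open import Algebra.Bundles using (CommutativeRing; Semiring)
open import Data.Nat as ℕ using (ℕ; suc; _∸_)
open import Data.Nat.DivMod using (_/_)
open import Data.Fin using (Fin)
open import Data.Product using (Σ; ∃; _×_)
open import Relation.Binary.PropositionalEquality using (_≡_)
open import Relation.Nullary using (¬_)
import Algebra.Definitions.RawSemiring as RS

module _ {c ℓ} (F : CommutativeRing c ℓ) where
  open CommutativeRing F
  open RS (Semiring.rawSemiring semiring) using () renaming (_^_ to _^ᶠ_)

  record IsField : Set (c ⊔ ℓ) where
    field
      nontrivial : ¬ (1# ≈ 0#)
      inverse    : ∀ x → ¬ (x ≈ 0#) → ∃ λ y → x * y ≈ 1#

  HasSize : ℕ → Set (c ⊔ ℓ)
  HasSize n = Σ (Fin n → Carrier) λ e →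
                (∀ i j → e i ≈ e j → i ≡ j) × (∀ x → ∃ λ i → e i ≈ x)

  Tr : ℕ → Carrier → Carrier
  Tr m x = x + x ^ᶠ (2 ℕ.^ m)

  fPoly : ℕ → Carrier → Carrier → Carrier
  fPoly m δ x =
    x + ((Tr m x) ^ᶠ ((2 ℕ.^ m ℕ.+ 1) / 3) + δ) ^ᶠ (2 ℕ.^ (m ∸ 1) ℕ.+ 1)

  fInv : ℕ → Carrier → Carrier → Carrier
  fInv m δ x =
    x + ((((Tr m x) ^ᶠ 2 + δ ^ᶠ 3 + δ ^ᶠ (3 ℕ.* 2 ℕ.^ m))
            ^ᶠ ((2 ℕ.^ (m ℕ.+ 1) ∸ 1) / 3))
          + δ ^ᶠ (2 ℕ.^ m)) ^ᶠ (2 ℕ.^ (m ∸ 1) ℕ.+ 1)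

{-# OPTIONS --safe #-}
module Submission where

-- Put q = 2^m. Since |F| = q², the map x ↦ x^q is an additive involution, and every trace
-- Tr(x) = x + x^q is fixed by it. Both maps have the form x ↦ x + u^E with E = q/2 + 1 and u
-- depending on x only through its trace, and in characteristic 2, for u = s + d with s fixed,
--   Tr(u^E)² = u^q u² + u u^{2q} = (s + d + d^q)³ + s³ + d³ + d^{3q}.
-- As m is odd, A = (q+1)/3 and B = (2q-1)/3 are integers, and on fixed elements (y^A)³ = y² and
-- (r³)^B = r. Hence u can be recovered from the trace of x + u^E, and the other map adds the
-- same u^E once more, which cancels it.

open import Algebra.Bundles using (CommutativeRing)
open import Data.Bool using (if_then_else_)
open import Data.Empty using (⊥-elim)
open import Data.Fin using (Fin; zero; suc; punchIn)
open import Data.Fin.Permutation using (Permutation; permutation)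
open import Data.Fin.Properties using (_≟_; punchInᵢ≢i)
open import Data.Nat as ℕ using (ℕ; zero; suc)
open import Data.Nat.Divisibility using (divides)
open import Data.Nat.DivMod using (_/_; m/n*n≡m)
import Data.Nat.Properties as ℕP
open import Data.Nat.Tactic.RingSolver using (solve-∀)
open import Data.Product using (∃; _×_; _,_; proj₁; proj₂)
open import Data.Vec.Functional using (removeAt; replicate)
open import Relation.Binary.Definitions using (Decidable)
open import Relation.Binary.PropositionalEquality as ≡ using (_≡_)
open import Relation.Nullary using (¬_; yes; no; does)
open import Defs

module FiniteField {a ℓ} (F : CommutativeRing a ℓ) (isField : IsField F) where
  open CommutativeRing F hiding (zero)
  open IsField isField
  open import Algebra.Properties.Semiring.Exp semiring using (_^_)
  open import Algebra.Properties.CommutativeMonoid.Sum *-commutativeMonoid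
    using (sum-permute; sum-cong-≋; ∑-distrib-+; sum-remove; sum-replicate)
    renaming (sum to product)
  open import Relation.Binary.Reasoning.Setoid setoid

  *-cancelˡ : ∀ {x y z} → ¬ x ≈ 0# → x * y ≈ x * z → y ≈ z
  *-cancelˡ {x} {y} {z} x≉0 xy≈xz with inverse x x≉0
  ... | x⁻¹ , xx⁻¹≈1 = begin
    y               ≈⟨ *-identityˡ y ⟨
    1# * y          ≈⟨ *-congʳ x⁻¹x≈1 ⟨
    (x⁻¹ * x) * y   ≈⟨ *-assoc x⁻¹ x y ⟩
    x⁻¹ * (x * y)   ≈⟨ *-congˡ xy≈xz ⟩
    x⁻¹ * (x * z)   ≈⟨ *-assoc x⁻¹ x z ⟨
    (x⁻¹ * x) * z   ≈⟨ *-congʳ x⁻¹x≈1 ⟩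
    1# * z          ≈⟨ *-identityˡ z ⟩
    z               ∎
    where
    x⁻¹x≈1 : x⁻¹ * x ≈ 1#
    x⁻¹x≈1 = trans (*-comm x⁻¹ x) xx⁻¹≈1

  *-nonzero : ∀ {x y} → ¬ x ≈ 0# → ¬ y ≈ 0# → ¬ x * y ≈ 0#
  *-nonzero x≉0 y≉0 xy≈0 = y≉0 (*-cancelˡ x≉0 (trans xy≈0 (sym (zeroʳ _))))

  product-nonzero : ∀ {k} (f : Fin k → Carrier) → (∀ i → ¬ f i ≈ 0#) → ¬ product f ≈ 0#
  product-nonzero {zero}  f f≉0 = nontrivial
  product-nonzero {suc k} f f≉0 =
    *-nonzero (f≉0 zero) (product-nonzero (λ i → f (suc i)) (λ i → f≉0 (suc i)))

  module _ {n} (size : HasSize F (suc n)) where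
    private
      enum : Fin (suc n) → Carrier
      enum = proj₁ size

      enum-injective : ∀ i j → enum i ≈ enum j → i ≡ j
      enum-injective = proj₁ (proj₂ size)

      index : Carrier → Fin (suc n)
      index x = proj₁ (proj₂ (proj₂ size) x)

      enum-index : ∀ x → enum (index x) ≈ x
      enum-index x = proj₂ (proj₂ (proj₂ size) x)

    ≈-dec : Decidable _≈_
    ≈-dec x y with index x ≟ index y
    ... | yes eq = yes (trans (sym (enum-index x)) (trans (reflexive (≡.cong enum eq)) (enum-index y)))
    ... | no neq = no λ x≈y →
      neq (enum-injective _ _ (trans (enum-index x) (trans x≈y (sym (enum-index y)))))

    private
      o : Fin (suc n)
      o = index 0#

      enum≈0⇒≡o : ∀ {i} → enum i ≈ 0# → i ≡ o
      enum≈0⇒≡o {i} p = enum-injective i o (trans p (sym (enum-index 0#)))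

      -- product enum* is the product of all units of F
      enum* : Fin (suc n) → Carrier
      enum* i = if does (i ≟ o) then 1# else enum i

      enum*-nonzero : ∀ i → ¬ enum* i ≈ 0#
      enum*-nonzero i with i ≟ o
      ... | yes _  = nontrivial
      ... | no i≢o = λ p → i≢o (enum≈0⇒≡o p)

    module _ {x : Carrier} (x≉0 : ¬ x ≈ 0#) where
      private
        x⁻¹ : Carrier
        x⁻¹ = proj₁ (inverse x x≉0)

        scaleBy : Carrier → Fin (suc n) → Fin (suc n)
        scaleBy a i = index (a * enum i)

        scaleBy-inverse : ∀ {a b} → a * b ≈ 1# → ∀ i → scaleBy a (scaleBy b i) ≡ i
        scaleBy-inverse {a} {b} ab≈1 i = enum-injective _ _ (begin
          enum (index (a * enum (index (b * enum i))))  ≈⟨ enum-index _ ⟩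
          a * enum (index (b * enum i))                 ≈⟨ *-congˡ (enum-index _) ⟩
          a * (b * enum i)                              ≈⟨ *-assoc a b (enum i) ⟨
          (a * b) * enum i                              ≈⟨ *-congʳ ab≈1 ⟩
          1# * enum i                                   ≈⟨ *-identityˡ (enum i) ⟩
          enum i                                        ∎)

        scaling : Permutation (suc n) (suc n)
        scaling = permutation (scaleBy x) (scaleBy x⁻¹)
          (scaleBy-inverse (proj₂ (inverse x x≉0)))
          (scaleBy-inverse (trans (*-comm x⁻¹ x) (proj₂ (inverse x x≉0))))

        scaleFactor : Fin (suc n) → Carrier
        scaleFactor i = if does (i ≟ o) then 1# else x

        enum*-scaleBy : ∀ i → enum* (scaleBy x i) ≈ scaleFactor i * enum* i
        enum*-scaleBy i with i ≟ o | scaleBy x i ≟ o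
        ... | yes _   | yes _   = sym (*-identityˡ 1#)
        ... | yes i≡o | no xi≢o = ⊥-elim (xi≢o (enum≈0⇒≡o (begin
          enum (scaleBy x i) ≈⟨ enum-index _ ⟩
          x * enum i         ≈⟨ *-congˡ (trans (reflexive (≡.cong enum i≡o)) (enum-index 0#)) ⟩
          x * 0#             ≈⟨ zeroʳ x ⟩
          0#                 ∎)))
        ... | no i≢o  | yes xi≡o = ⊥-elim (i≢o (enum≈0⇒≡o (*-cancelˡ x≉0 (begin
          x * enum i         ≈⟨ enum-index _ ⟨
          enum (scaleBy x i) ≈⟨ reflexive (≡.cong enum xi≡o) ⟩
          enum o             ≈⟨ enum-index 0# ⟩
          0#                 ≈⟨ zeroʳ x ⟨
          x * 0#             ∎))))
        ... | no _    | no _    = enum-index _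

        scaleFactor-punchIn : ∀ j → scaleFactor (punchIn o j) ≈ x
        scaleFactor-punchIn j with punchIn o j ≟ o
        ... | yes eq = ⊥-elim (punchInᵢ≢i o j eq)
        ... | no _   = refl

        scaleFactor-o : scaleFactor o ≈ 1#
        scaleFactor-o with o ≟ o
        ... | yes _  = refl
        ... | no o≢o = ⊥-elim (o≢o ≡.refl)

        product-scaleFactor : product scaleFactor ≈ x ^ n
        product-scaleFactor = begin
          product scaleFactor                               ≈⟨ sum-remove {i = o} scaleFactor ⟩
          scaleFactor o * product (removeAt scaleFactor o)  ≈⟨ *-cong scaleFactor-o (sum-cong-≋ scaleFactor-punchIn) ⟩
          1# * product (replicate n x)                      ≈⟨ *-identityˡ _ ⟩
          product (replicate n x)                           ≈⟨ sum-replicate n ⟩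
          x ^ n                                             ∎

      -- Multiplication by x permutes F and fixes 0, so it scales the product of all units by x^(|F|-1).
      x^∣F∣-1≈1 : x ^ n ≈ 1#
      x^∣F∣-1≈1 = *-cancelˡ (product-nonzero enum* enum*-nonzero) (begin
        product enum* * x ^ n                          ≈⟨ *-comm _ _ ⟩
        x ^ n * product enum*                          ≈⟨ *-congʳ product-scaleFactor ⟨
        product scaleFactor * product enum*            ≈⟨ ∑-distrib-+ scaleFactor enum* ⟨
        product (λ i → scaleFactor i * enum* i)        ≈⟨ sum-cong-≋ enum*-scaleBy ⟨
        product (λ i → enum* (scaleBy x i))            ≈⟨ sum-permute enum* scaling ⟨
        product enum*                                  ≈⟨ *-identityʳ _ ⟨
        product enum* * 1#                             ∎)

  x^∣F∣≈x : ∀ {n} → HasSize F n → ∀ x → x ^ n ≈ x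
  x^∣F∣≈x {zero}  (_ , _ , surjective) x with surjective x
  ... | () , _
  x^∣F∣≈x {suc n} size x with ≈-dec size x 0#
  ... | yes x≈0 = trans (*-congʳ x≈0) (trans (zeroˡ _) (sym x≈0))
  ... | no x≉0  = trans (*-congˡ (x^∣F∣-1≈1 size x≉0)) (*-identityʳ x)

module RingLemmas {a ℓ} (R : CommutativeRing a ℓ) where
  open CommutativeRing R
  open import Algebra.Properties.Semiring.Exp semiring
  open import Algebra.Properties.Ring ring using (-1*x≈-x; -‿involutive)
  open import Algebra.Solver.Ring.NaturalCoefficients.Default commutativeSemiring
  open import Relation.Binary.Reasoning.Setoid setoid

  ^-comm : ∀ x i j → (x ^ i) ^ j ≈ (x ^ j) ^ i
  ^-comm x i j = trans (^-assocʳ x i j) (trans (^-congʳ x (ℕP.*-comm i j)) (sym (^-assocʳ x j i)))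

  1^n≈1 : ∀ n → 1# ^ n ≈ 1#
  1^n≈1 zero    = refl
  1^n≈1 (suc n) = trans (*-identityˡ _) (1^n≈1 n)

  x^[2h]≈x⇒x+x≈0 : ∀ h → (∀ x → x ^ (2 ℕ.* h) ≈ x) → ∀ x → x + x ≈ 0#
  x^[2h]≈x⇒x+x≈0 h x^[2h]≈x x = begin
    x + x            ≈⟨ +-congˡ (*-identityˡ x) ⟨
    x + 1# * x       ≈⟨ +-congˡ (*-congʳ -1≈1) ⟨
    x + - 1# * x     ≈⟨ +-congˡ (-1*x≈-x x) ⟩
    x - x            ≈⟨ -‿inverseʳ x ⟩
    0#               ∎
    where
    [-1]²≈1 : (- 1#) ^ 2 ≈ 1#
    [-1]²≈1 = begin
      - 1# * (- 1# * 1#)    ≈⟨ *-congˡ (*-identityʳ (- 1#)) ⟩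
      - 1# * - 1#           ≈⟨ -1*x≈-x (- 1#) ⟩
      - - 1#                ≈⟨ -‿involutive 1# ⟩
      1#                    ∎
    -1≈1 : - 1# ≈ 1#
    -1≈1 = begin
      - 1#                  ≈⟨ x^[2h]≈x (- 1#) ⟨
      (- 1#) ^ (2 ℕ.* h)    ≈⟨ ^-assocʳ (- 1#) 2 h ⟨
      ((- 1#) ^ 2) ^ h      ≈⟨ ^-congˡ h [-1]²≈1 ⟩
      1# ^ h                ≈⟨ 1^n≈1 h ⟩
      1#                    ∎

  x^[2h]≈x⇒^2-injective : ∀ h → (∀ x → x ^ (2 ℕ.* h) ≈ x) → ∀ {x y} → x ^ 2 ≈ y ^ 2 → x ≈ y
  x^[2h]≈x⇒^2-injective h x^[2h]≈x {x} {y} x²≈y² = begin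
    x                 ≈⟨ x^[2h]≈x x ⟨
    x ^ (2 ℕ.* h)     ≈⟨ ^-assocʳ x 2 h ⟨
    (x ^ 2) ^ h       ≈⟨ ^-congˡ h x²≈y² ⟩
    (y ^ 2) ^ h       ≈⟨ ^-assocʳ y 2 h ⟩
    y ^ (2 ℕ.* h)     ≈⟨ x^[2h]≈x y ⟩
    y                 ∎

  module CharacteristicTwo (x+x≈0 : ∀ x → x + x ≈ 0#) where

    x+y+y≈x : ∀ x y → x + y + y ≈ x
    x+y+y≈x x y = begin
      x + y + y    ≈⟨ +-assoc x y y ⟩
      x + (y + y)  ≈⟨ +-congˡ (x+x≈0 y) ⟩
      x + 0#       ≈⟨ +-identityʳ x ⟩
      x            ∎

    x≈y+[z+z]⇒x≈y : ∀ {x y} z → x ≈ y + (z + z) → x ≈ y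
    x≈y+[z+z]⇒x≈y {x} {y} z x≈y+2z = begin
      x            ≈⟨ x≈y+2z ⟩
      y + (z + z)  ≈⟨ +-congˡ (x+x≈0 z) ⟩
      y + 0#       ≈⟨ +-identityʳ y ⟩
      y            ∎

    [x+y]²≈x²+y² : ∀ x y → (x + y) ^ 2 ≈ x ^ 2 + y ^ 2
    [x+y]²≈x²+y² x y = x≈y+[z+z]⇒x≈y (x * y)
      (solve 2 (λ x y → (x :+ y) :^ 2 := x :^ 2 :+ y :^ 2 :+ (x :* y :+ x :* y)) refl x y)

    frobenius : ∀ j x y → (x + y) ^ (2 ℕ.^ j) ≈ x ^ (2 ℕ.^ j) + y ^ (2 ℕ.^ j)
    frobenius zero    x y = trans (*-identityʳ (x + y)) (sym (+-cong (*-identityʳ x) (*-identityʳ y)))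
    frobenius (suc j) x y = begin
      (x + y) ^ (2 ℕ.* n)           ≈⟨ x^[2n]≈[x^n]² (x + y) ⟩
      ((x + y) ^ n) ^ 2             ≈⟨ ^-congˡ 2 (frobenius j x y) ⟩
      (x ^ n + y ^ n) ^ 2           ≈⟨ [x+y]²≈x²+y² (x ^ n) (y ^ n) ⟩
      (x ^ n) ^ 2 + (y ^ n) ^ 2     ≈⟨ +-cong (x^[2n]≈[x^n]² x) (x^[2n]≈[x^n]² y) ⟨
      x ^ (2 ℕ.* n) + y ^ (2 ℕ.* n) ∎
      where
      n : ℕ
      n = 2 ℕ.^ j
      x^[2n]≈[x^n]² : ∀ x → x ^ (2 ℕ.* n) ≈ (x ^ n) ^ 2
      x^[2n]≈[x^n]² x = trans (^-congʳ x (ℕP.*-comm 2 n)) (sym (^-assocʳ x n 2))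

    [a+c][a+b]²+[a+b][a+c]²≈[a+b+c]³+a³+b³+c³ : ∀ a b c →
      (a + c) * (a + b) ^ 2 + (a + b) * (a + c) ^ 2 ≈ (a + (b + c)) ^ 3 + a ^ 3 + b ^ 3 + c ^ 3
    [a+c][a+b]²+[a+b][a+c]²≈[a+b+c]³+a³+b³+c³ a b c = sym (x≈y+[z+z]⇒x≈y
      (b ^ 3 + c ^ 3 + a * b ^ 2 + a * c ^ 2 + b ^ 2 * c + b * c ^ 2 + a * b * c)
      (solve 3 (λ a b c →
          (a :+ (b :+ c)) :^ 3 :+ a :^ 3 :+ b :^ 3 :+ c :^ 3
        := (a :+ c) :* (a :+ b) :^ 2 :+ (a :+ b) :* (a :+ c) :^ 2
           :+ (Z a b c :+ Z a b c)) refl a b c))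
      where
      Z : ∀ {n} → Polynomial n → Polynomial n → Polynomial n → Polynomial n
      Z a b c = b :^ 3 :+ c :^ 3 :+ a :* b :^ 2 :+ a :* c :^ 2 :+ b :^ 2 :* c :+ b :* c :^ 2 :+ a :* b :* c

4^k≡3c+1 : ∀ k → ∃ λ c → 4 ℕ.^ k ≡ 3 ℕ.* c ℕ.+ 1
4^k≡3c+1 zero    = 0 , ≡.refl
4^k≡3c+1 (suc k) with 4^k≡3c+1 k
... | c , 4^k≡3c+1 = 4 ℕ.* c ℕ.+ 1 , ≡.trans (≡.cong (4 ℕ.*_) 4^k≡3c+1) (4[3c+1]≡3[4c+1]+1 c)
  where
  4[3c+1]≡3[4c+1]+1 : ∀ c → 4 ℕ.* (3 ℕ.* c ℕ.+ 1) ≡ 3 ℕ.* (4 ℕ.* c ℕ.+ 1) ℕ.+ 1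
  4[3c+1]≡3[4c+1]+1 = solve-∀

module OddExponents (k : ℕ) where
  open import Data.Nat using (_+_; _*_; _^_; _∸_; pred)

  m q A B E : ℕ
  m = suc (2 * k)
  q = 2 ^ m
  A = (2 ^ m + 1) / 3
  B = (2 ^ (m + 1) ∸ 1) / 3
  E = 2 ^ (m ∸ 1) + 1

  private
    c : ℕ
    c = proj₁ (4^k≡3c+1 k)

    q≡2+6c : q ≡ 2 + 6 * c
    q≡2+6c = ≡.trans (≡.cong (2 *_) 2^[2k]≡3c+1) (2[3c+1]≡2+6c c)
      where
      2^[2k]≡3c+1 : 2 ^ (2 * k) ≡ 3 * c + 1
      2^[2k]≡3c+1 = ≡.trans (≡.sym (ℕP.^-*-assoc 2 2 k)) (proj₂ (4^k≡3c+1 k))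
      2[3c+1]≡2+6c : ∀ c → 2 * (3 * c + 1) ≡ 2 + 6 * c
      2[3c+1]≡2+6c = solve-∀

  A*3≡q+1 : A * 3 ≡ q + 1
  A*3≡q+1 = m/n*n≡m (divides (1 + 2 * c) (≡.trans (≡.cong (_+ 1) q≡2+6c) (2+6c+1≡[1+2c]*3 c)))
    where
    2+6c+1≡[1+2c]*3 : ∀ c → 2 + 6 * c + 1 ≡ (1 + 2 * c) * 3
    2+6c+1≡[1+2c]*3 = solve-∀

  B*3≡q+pred[q] : B * 3 ≡ q + pred q
  B*3≡q+pred[q] = begin
    B * 3                           ≡⟨ m/n*n≡m (divides (1 + 4 * c) (≡.cong pred 2^[m+1]≡1+[1+4c]*3)) ⟩
    2 ^ (m + 1) ∸ 1                 ≡⟨ ≡.cong pred 2^[m+1]≡1+[1+4c]*3 ⟩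
    (1 + 4 * c) * 3                 ≡⟨ [1+4c]*3≡[2+6c]+[1+6c] c ⟩
    (2 + 6 * c) + pred (2 + 6 * c)  ≡⟨ ≡.cong (λ n → n + pred n) q≡2+6c ⟨
    q + pred q                      ∎
    where
    open ≡.≡-Reasoning
    [2+6c]*2≡1+[1+4c]*3 : ∀ c → (2 + 6 * c) * 2 ≡ 1 + (1 + 4 * c) * 3
    [2+6c]*2≡1+[1+4c]*3 = solve-∀
    [1+4c]*3≡[2+6c]+[1+6c] : ∀ c → (1 + 4 * c) * 3 ≡ (2 + 6 * c) + (1 + 6 * c)
    [1+4c]*3≡[2+6c]+[1+6c] = solve-∀
    2^[m+1]≡1+[1+4c]*3 : 2 ^ (m + 1) ≡ 1 + (1 + 4 * c) * 3
    2^[m+1]≡1+[1+4c]*3 = ≡.trans (ℕP.^-distribˡ-+-* 2 m 1) (≡.trans (≡.cong (_* 2) q≡2+6c) ([2+6c]*2≡1+[1+4c]*3 c))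

  suc[pred[q]]≡q : ℕ.suc (pred q) ≡ q
  suc[pred[q]]≡q = ≡.trans (≡.cong (λ n → ℕ.suc (pred n)) q≡2+6c) (≡.sym q≡2+6c)

  E*2≡q+2 : E * 2 ≡ q + 2
  E*2≡q+2 = [n+1]*2≡2n+2 (2 ^ (2 * k))
    where
    [n+1]*2≡2n+2 : ∀ n → (n + 1) * 2 ≡ 2 * n + 2
    [n+1]*2≡2n+2 = solve-∀

  q*q≡2^[2m] : q * q ≡ 2 ^ (2 * m)
  q*q≡2^[2m] = ≡.trans (≡.sym (ℕP.^-distribˡ-+-* 2 m m)) (≡.cong (λ n → 2 ^ (m + n)) (≡.sym (ℕP.+-identityʳ m)))

module Inversion {a ℓ} (R : CommutativeRing a ℓ) (k : ℕ) where
  open CommutativeRing R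
  open import Algebra.Properties.Semiring.Exp semiring
  open import Algebra.Solver.Ring.NaturalCoefficients.Default commutativeSemiring
  open import Relation.Binary.Reasoning.Setoid setoid
  open OddExponents k
  open RingLemmas R

  module _ (x^[q²]≈x : ∀ x → x ^ (2 ℕ.^ (2 ℕ.* m)) ≈ x) where
    -- 2 ^ (2 * m) is 2 * 2 ^ pred (2 * m) by computation, m being a successor.
    open CharacteristicTwo (x^[2h]≈x⇒x+x≈0 (2 ℕ.^ ℕ.pred (2 ℕ.* m)) x^[q²]≈x)

    ^2-injective : ∀ {x y} → x ^ 2 ≈ y ^ 2 → x ≈ y
    ^2-injective = x^[2h]≈x⇒^2-injective (2 ℕ.^ ℕ.pred (2 ℕ.* m)) x^[q²]≈x

    Tr′ : Carrier → Carrier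
    Tr′ = Tr R m

    Fixed : Carrier → Set ℓ
    Fixed x = x ^ q ≈ x

    [x^q]^q≈x : ∀ x → (x ^ q) ^ q ≈ x
    [x^q]^q≈x x = trans (^-assocʳ x q q) (trans (^-congʳ x q*q≡2^[2m]) (x^[q²]≈x x))

    fixed-resp : ∀ {x y} → x ≈ y → Fixed y → Fixed x
    fixed-resp x≈y y^q≈y = trans (^-congˡ q x≈y) (trans y^q≈y (sym x≈y))

    fixed-+ : ∀ {x y} → Fixed x → Fixed y → Fixed (x + y)
    fixed-+ x^q≈x y^q≈y = trans (frobenius m _ _) (+-cong x^q≈x y^q≈y)

    fixed-^ : ∀ {x} n → Fixed x → Fixed (x ^ n)
    fixed-^ {x} n x^q≈x = trans (^-comm x n q) (^-congˡ n x^q≈x)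

    Tr-fixed : ∀ x → Fixed (Tr′ x)
    Tr-fixed x = trans (frobenius m x (x ^ q)) (trans (+-congˡ ([x^q]^q≈x x)) (+-comm _ _))

    Tr-+ : ∀ x y → Tr′ (x + y) ≈ Tr′ x + Tr′ y
    Tr-+ x y = trans (+-congˡ (frobenius m x y))
      (solve 4 (λ x y x′ y′ → (x :+ y) :+ (x′ :+ y′) := (x :+ x′) :+ (y :+ y′)) refl x y (x ^ q) (y ^ q))

    fixed⇒x^[q+n]≈x^[1+n] : ∀ {x} → Fixed x → ∀ n → x ^ (q ℕ.+ n) ≈ x ^ suc n
    fixed⇒x^[q+n]≈x^[1+n] {x} x^q≈x n = trans (^-homo-* x q n) (*-congʳ x^q≈x)

    fixed⇒[x^A]³≈x² : ∀ {x} → Fixed x → (x ^ A) ^ 3 ≈ x ^ 2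
    fixed⇒[x^A]³≈x² {x} x^q≈x = begin
      (x ^ A) ^ 3     ≈⟨ ^-assocʳ x A 3 ⟩
      x ^ (A ℕ.* 3)   ≈⟨ ^-congʳ x A*3≡q+1 ⟩
      x ^ (q ℕ.+ 1)   ≈⟨ fixed⇒x^[q+n]≈x^[1+n] x^q≈x 1 ⟩
      x ^ 2           ∎

    fixed⇒[x³]^B≈x : ∀ {x} → Fixed x → (x ^ 3) ^ B ≈ x
    fixed⇒[x³]^B≈x {x} x^q≈x = begin
      (x ^ 3) ^ B            ≈⟨ ^-comm x 3 B ⟩
      (x ^ B) ^ 3            ≈⟨ ^-assocʳ x B 3 ⟩
      x ^ (B ℕ.* 3)          ≈⟨ ^-congʳ x B*3≡q+pred[q] ⟩
      x ^ (q ℕ.+ ℕ.pred q)   ≈⟨ fixed⇒x^[q+n]≈x^[1+n] x^q≈x (ℕ.pred q) ⟩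
      x ^ suc (ℕ.pred q)     ≈⟨ ^-congʳ x suc[pred[q]]≡q ⟩
      x ^ q                  ≈⟨ x^q≈x ⟩
      x                      ∎

    [x^E]²≈x^q*x² : ∀ x → (x ^ E) ^ 2 ≈ x ^ q * x ^ 2
    [x^E]²≈x^q*x² x = begin
      (x ^ E) ^ 2      ≈⟨ ^-assocʳ x E 2 ⟩
      x ^ (E ℕ.* 2)    ≈⟨ ^-congʳ x E*2≡q+2 ⟩
      x ^ (q ℕ.+ 2)    ≈⟨ ^-homo-* x q 2 ⟩
      x ^ q * x ^ 2    ∎

    Tr[x+[s+d]^E]² : ∀ x {s} d → Fixed s →
      Tr′ (x + (s + d) ^ E) ^ 2 ≈ Tr′ x ^ 2 + ((s + (d + d ^ q)) ^ 3 + s ^ 3 + d ^ 3 + (d ^ q) ^ 3)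
    Tr[x+[s+d]^E]² x {s} d s^q≈s = begin
      Tr′ (x + y) ^ 2            ≈⟨ ^-congˡ 2 (Tr-+ x y) ⟩
      (Tr′ x + Tr′ y) ^ 2        ≈⟨ [x+y]²≈x²+y² (Tr′ x) (Tr′ y) ⟩
      Tr′ x ^ 2 + Tr′ y ^ 2      ≈⟨ +-congˡ Tr[y]² ⟩
      Tr′ x ^ 2 + ((s + (d + d ^ q)) ^ 3 + s ^ 3 + d ^ 3 + (d ^ q) ^ 3) ∎
      where
      u y : Carrier
      u = s + d
      y = u ^ E
      u^q≈s+d^q : u ^ q ≈ s + d ^ q
      u^q≈s+d^q = trans (frobenius m s d) (+-congʳ s^q≈s)
      Tr[y]² : Tr′ y ^ 2 ≈ (s + (d + d ^ q)) ^ 3 + s ^ 3 + d ^ 3 + (d ^ q) ^ 3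
      Tr[y]² = begin
        (y + y ^ q) ^ 2                               ≈⟨ [x+y]²≈x²+y² y (y ^ q) ⟩
        y ^ 2 + (y ^ q) ^ 2                           ≈⟨ +-congˡ (^-congˡ 2 (^-comm u E q)) ⟩
        y ^ 2 + ((u ^ q) ^ E) ^ 2                     ≈⟨ +-cong ([x^E]²≈x^q*x² u) ([x^E]²≈x^q*x² (u ^ q)) ⟩
        u ^ q * u ^ 2 + (u ^ q) ^ q * (u ^ q) ^ 2     ≈⟨ +-cong (*-congʳ u^q≈s+d^q)
                                                          (*-cong ([x^q]^q≈x u) (^-congˡ 2 u^q≈s+d^q)) ⟩
        (s + d ^ q) * u ^ 2 + u * (s + d ^ q) ^ 2     ≈⟨ [a+c][a+b]²+[a+b][a+c]²≈[a+b+c]³+a³+b³+c³ s d (d ^ q) ⟩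
        (s + (d + d ^ q)) ^ 3 + s ^ 3 + d ^ 3 + (d ^ q) ^ 3 ∎

    δ^[3q]≈[δ^q]³ : ∀ δ → δ ^ (3 ℕ.* q) ≈ (δ ^ q) ^ 3
    δ^[3q]≈[δ^q]³ δ = trans (^-congʳ δ (ℕP.*-comm 3 q)) (sym (^-assocʳ δ q 3))

    t²+δ³+δ^[3q]-fixed : ∀ {t} δ → Fixed t → Fixed (t ^ 2 + δ ^ 3 + δ ^ (3 ℕ.* q))
    t²+δ³+δ^[3q]-fixed δ t-fixed =
      fixed-resp (trans (+-assoc _ _ _) (+-congˡ (+-congˡ (sym (^-assocʳ δ 3 q)))))
        (fixed-+ (fixed-^ 2 t-fixed) (Tr-fixed (δ ^ 3)))

    x²≈r³⇒x^A≈r : ∀ {x r} → Fixed r → x ^ 2 ≈ r ^ 3 → x ^ A ≈ r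
    x²≈r³⇒x^A≈r {x} {r} r-fixed x²≈r³ = ^2-injective (begin
      (x ^ A) ^ 2    ≈⟨ ^-comm x A 2 ⟩
      (x ^ 2) ^ A    ≈⟨ ^-congˡ A x²≈r³ ⟩
      (r ^ 3) ^ A    ≈⟨ ^-comm r 3 A ⟩
      (r ^ A) ^ 3    ≈⟨ fixed⇒[x^A]³≈x² r-fixed ⟩
      r ^ 2          ∎)

    x+u^E+v^E≈x : ∀ x {u v} → v ≈ u → x + u ^ E + v ^ E ≈ x
    x+u^E+v^E≈x x {u} v≈u = trans (+-congˡ (^-congˡ E v≈u)) (x+y+y≈x x (u ^ E))

    fInv∘fPoly≈id : ∀ δ x → fInv R m δ (fPoly R m δ x) ≈ x
    fInv∘fPoly≈id δ x = x+u^E+v^E≈x x (begin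
      c ^ B + δ ^ q                ≈⟨ +-congʳ (trans (^-congˡ B c≈r³) (fixed⇒[x³]^B≈x r-fixed)) ⟩
      s + (δ + δ ^ q) + δ ^ q      ≈⟨ +-assoc s _ _ ⟩
      s + (δ + δ ^ q + δ ^ q)      ≈⟨ +-congˡ (x+y+y≈x δ (δ ^ q)) ⟩
      s + δ                        ∎)
      where
      t s c r : Carrier
      t = Tr′ x
      s = t ^ A
      c = Tr′ (fPoly R m δ x) ^ 2 + δ ^ 3 + δ ^ (3 ℕ.* q)
      r = s + Tr′ δ
      r-fixed : Fixed r
      r-fixed = fixed-+ (fixed-^ A (Tr-fixed x)) (Tr-fixed δ)
      c≈r³ : c ≈ r ^ 3
      c≈r³ = begin
        c
          ≈⟨ +-cong (+-congʳ (Tr[x+[s+d]^E]² x δ (fixed-^ A (Tr-fixed x)))) (δ^[3q]≈[δ^q]³ δ) ⟩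
        t ^ 2 + (r ^ 3 + s ^ 3 + δ ^ 3 + (δ ^ q) ^ 3) + δ ^ 3 + (δ ^ q) ^ 3
          ≈⟨ +-congʳ (+-congʳ (+-congˡ (+-congʳ (+-congʳ (+-congˡ (fixed⇒[x^A]³≈x² (Tr-fixed x))))))) ⟩
        t ^ 2 + (r ^ 3 + t ^ 2 + δ ^ 3 + (δ ^ q) ^ 3) + δ ^ 3 + (δ ^ q) ^ 3
          ≈⟨ x≈y+[z+z]⇒x≈y (t ^ 2 + δ ^ 3 + (δ ^ q) ^ 3)
               (solve 4 (λ t² r³ δ³ δ′³ → t² :+ (r³ :+ t² :+ δ³ :+ δ′³) :+ δ³ :+ δ′³
                                          := r³ :+ ((t² :+ δ³ :+ δ′³) :+ (t² :+ δ³ :+ δ′³)))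
                 refl (t ^ 2) (r ^ 3) (δ ^ 3) ((δ ^ q) ^ 3)) ⟩
        r ^ 3 ∎

    fPoly∘fInv≈id : ∀ δ x → fPoly R m δ (fInv R m δ x) ≈ x
    fPoly∘fInv≈id δ x = x+u^E+v^E≈x x (begin
      z ^ A + δ                      ≈⟨ +-congʳ (x²≈r³⇒x^A≈r r-fixed z²≈r³) ⟩
      w + (δ ^ q + (δ ^ q) ^ q) + δ  ≈⟨ +-congʳ (+-congˡ (+-congˡ ([x^q]^q≈x δ))) ⟩
      w + (δ ^ q + δ) + δ            ≈⟨ +-assoc w _ _ ⟩
      w + (δ ^ q + δ + δ)            ≈⟨ +-congˡ (x+y+y≈x (δ ^ q) δ) ⟩
      w + δ ^ q                      ∎)
      where
      t c w z r : Carrier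
      t = Tr′ x
      c = t ^ 2 + δ ^ 3 + δ ^ (3 ℕ.* q)
      w = c ^ B
      z = Tr′ (fInv R m δ x)
      r = w + Tr′ (δ ^ q)
      c-fixed : Fixed c
      c-fixed = t²+δ³+δ^[3q]-fixed δ (Tr-fixed x)
      r-fixed : Fixed r
      r-fixed = fixed-+ (fixed-^ B c-fixed) (Tr-fixed (δ ^ q))
      w³≈t²+δ³+[δ^q]³ : w ^ 3 ≈ t ^ 2 + δ ^ 3 + (δ ^ q) ^ 3
      w³≈t²+δ³+[δ^q]³ = trans (^-comm c B 3) (trans (fixed⇒[x³]^B≈x c-fixed) (+-congˡ (δ^[3q]≈[δ^q]³ δ)))
      z²≈r³ : z ^ 2 ≈ r ^ 3
      z²≈r³ = begin
        z ^ 2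
          ≈⟨ Tr[x+[s+d]^E]² x (δ ^ q) (fixed-^ B c-fixed) ⟩
        t ^ 2 + (r ^ 3 + w ^ 3 + (δ ^ q) ^ 3 + ((δ ^ q) ^ q) ^ 3)
          ≈⟨ +-congˡ (+-cong (+-congʳ (+-congˡ w³≈t²+δ³+[δ^q]³)) (^-congˡ 3 ([x^q]^q≈x δ))) ⟩
        t ^ 2 + (r ^ 3 + (t ^ 2 + δ ^ 3 + (δ ^ q) ^ 3) + (δ ^ q) ^ 3 + δ ^ 3)
          ≈⟨ x≈y+[z+z]⇒x≈y (t ^ 2 + δ ^ 3 + (δ ^ q) ^ 3)
               (solve 4 (λ t² r³ δ³ δ′³ → t² :+ (r³ :+ (t² :+ δ³ :+ δ′³) :+ δ′³ :+ δ³)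
                                          := r³ :+ ((t² :+ δ³ :+ δ′³) :+ (t² :+ δ³ :+ δ′³)))
                 refl (t ^ 2) (r ^ 3) (δ ^ 3) ((δ ^ q) ^ 3)) ⟩
        r ^ 3 ∎

open import Data.Nat using (_*_; _^_)

theorem7 : ∀ {c ℓ} (m : ℕ) → (∃ λ k → m ≡ suc (2 * k)) →
    (F : CommutativeRing c ℓ) → IsField F → HasSize F (2 ^ (2 * m)) →
    (δ : CommutativeRing.Carrier F) →
    (∀ x → CommutativeRing._≈_ F (fInv F m δ (fPoly F m δ x)) x) ×
    (∀ x → CommutativeRing._≈_ F (fPoly F m δ (fInv F m δ x)) x)
theorem7 m (k , ≡.refl) F isField size δ =
  fInv∘fPoly≈id (x^∣F∣≈x size) δ , fPoly∘fInv≈id (x^∣F∣≈x size) δ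
  where
  open FiniteField F isField using (x^∣F∣≈x)
  open Inversion F k using (fInv∘fPoly≈id; fPoly∘fInv≈id)
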